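{- Let $T$ be a finite tree, rooted and embedded in the plane as in the context. If two vertices $u$ and $v$ of $K_4T$ have the same non-empty neighbourhood, then they have the same second coordinate, i.e. $u=(k,x,p,q)$ and $v=(l,x,r,s)$ for one and the same vertex $x$ of $T$.
   Context: Let $T$ be a finite tree embedded in the plane, rooted at a vertex $\star$ of degree one; $d(x)$ denotes the degree of $x$ in $T$. At each vertex $x$ the incident edges are numbered $0,1,\dots,d(x)-1$ via the embedding, edge $0$ being the edge at $x$ lying on the unique path from $x$ to $\star$. For distinct vertices $x,y$: $y$ lies on $x$-direction $i$ ($1\le i\le d(x)-1$) if $x$ lies on the unique path from $y$ to $\star$ and this path contains the $i$-th edge at $x$; then $x$ lies on $y$-direction $0$. If $x$ is not on the $y\star$ path and $y$ is not on the $x\star$ path, $x$ and $y$ are not stacked and each lies on the other's direction $0$; otherwise they are stacked. $K_4T$: vertices are $4$-tuples $(k,x,p,q)$ with $x\in V(T)$, $d(x)\ge 3$, $k$ a non-negative integer, $p=(p_1,\dots,p_{l(p)})$, $q=(q_1,\dots,q_{l(q)})$ vectors of non-negative integers, $p$ having a positive entry, $l(p)+l(q)=d(x)-1$, and the sum of all entries of $p$ and $q$ equal to $3-k$. Vertices $v,w$ are adjacent iff for one ordering, writing $v=(k_1,x_1,p_1,q_1)$, $w=(k_2,x_2,p_2,q_2)$: (1) $x_1,x_2$ not stacked and $k_1+k_2\ge4$; or (2) $x_2$ lies on $x_1$-direction $i$, $1\le i\le l(p_1)$, and either $p_{1,i}>4-k_2$, or $p_{1,i}+k_2=4$ and $p_{1,j}\ne0$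 for some $j\neq i$; or (3) $x_2$ lies on $x_1$-direction $i>l(p_1)$ and $q_{1,i-l(p_1)}>4-k_2$. -}

module Defs where

open import Data.Nat using (ℕ; zero; suc; _+_; _∸_; _≤_; _<_)
open import Data.Unit using (⊤)
open import Data.List using (List; []; _∷_; _++_; length)
open import Data.Nat.ListAction using (sum)
open import Data.List.Relation.Unary.Any using (Any)
open import Data.Product using (Σ; ∃; ∃-syntax; _×_; _,_)
open import Data.Sum using (_⊎_)
open import Relation.Binary.PropositionalEquality using (_≡_; _≢_)
open import Relation.Nullary using (¬_)

-- The plane tree T rooted at the leaf ★ is represented by the
-- ordered tree  t  hanging below the unique neighbour of ★.  At a vertex
-- x ≠ ★ the edges numbered via the embedding starting from edge 0 (towards ★)
-- are: edge 0 = parent edge, edge c+1 = edge to the c-th child (0-based).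
-- Hence d(x) = 1 + (number of children of x).

data Tree : Set where
  node : List Tree → Tree

children : Tree → List Tree
children (node ts) = ts

-- c-th element of a list of trees (default for out-of-range indices;
-- only used under a range hypothesis)
nthT : List Tree → ℕ → Tree
nthT []       _       = node []
nthT (t ∷ ts) zero    = t
nthT (t ∷ ts) (suc c) = nthT ts c

-- c-th entry of a list of naturals (0-based; default 0 out of range,
-- only used under a range hypothesis)
nth : List ℕ → ℕ → ℕ
nth []       _       = 0
nth (x ∷ xs) zero    = x
nth (x ∷ xs) (suc c) = nth xs c

-- Vertices of T other than ★ are addresses: lists of 0-based child indices
-- starting from the neighbour of ★ (address []).
Valid : Tree → List ℕ → Set
Valid t        []      = ⊤
Valid (node ts) (c ∷ a) = (c < length ts) × Valid (nthT ts c) a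

subtree : Tree → List ℕ → Tree
subtree t         []      = t
subtree (node ts) (c ∷ a) = subtree (nthT ts c) a

deg : Tree → List ℕ → ℕ
deg t a = suc (length (children (subtree t a)))

-- y lies on x-direction (c+1), c 0-based child index: x lies on the path
-- from y to ★ and that path uses the (c+1)-th edge at x.
OnDir : List ℕ → ℕ → List ℕ → Set
OnDir x c y = ∃[ rest ] (y ≡ x ++ (c ∷ rest))

-- x lies on the path from y to ★ (including x = y)
Below : List ℕ → List ℕ → Set
Below x y = ∃[ rest ] (y ≡ x ++ rest)

Stacked : List ℕ → List ℕ → Set
Stacked x y = Below x y ⊎ Below y x

record K4V (t : Tree) : Set where
  constructor mkV
  field
    k    : ℕ
    x    : List ℕ
    p    : List ℕ
    q    : List ℕ
    x-valid : Valid t x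
    deg≥3   : 3 ≤ deg t x
    p-pos   : Any (λ e → 0 < e) p
    lengths : length p + length q ≡ deg t x ∸ 1
    total   : sum p + sum q + k ≡ 3

open K4V public

-- one-directional adjacency condition, v = (k₁,x₁,p₁,q₁), w = (k₂,x₂,p₂,q₂)
-- (integer inequality a > 4 - k₂ written as a + k₂ > 4)
AdjDir : {t : Tree} → K4V t → K4V t → Set
AdjDir v w =
    (¬ Stacked (x v) (x w) × 4 ≤ k v + k w)
  ⊎ (∃[ c ] (OnDir (x v) c (x w) × c < length (p v) ×
        ( 4 < nth (p v) c + k w
        ⊎ (nth (p v) c + k w ≡ 4 ×
           ∃[ j ] (j < length (p v) × j ≢ c × nth (p v) j ≢ 0)))))
  ⊎ (∃[ c ] (OnDir (x v) c (x w) × length (p v) ≤ c ×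
        4 < nth (q v) (c ∸ length (p v)) + k w))

Adj : {t : Tree} → K4V t → K4V t → Set
Adj v w = AdjDir v w ⊎ AdjDir w v

{-# OPTIONS --safe #-}
-- Every vertex has charge k ≤ 2, and a vertex of charge ≤ 1 is adjacent only
-- to vertices strictly beyond it (on one of its directions ≥ 1).  Vertices at
-- the same position of T are never adjacent, so if u, v are twins with a
-- neighbour w and x u ≠ x v, it suffices to find a neighbour of one of them
-- positioned at the other.  If x u, x v are not stacked and k u = 2, take
-- (2, x v, (1), 0); if both charges are ≤ 1, then w lies beyond both, so they
-- are stacked.  If x u lies on v-direction c + 1 and k u = 2, take
-- (0, x v, (0, …, 0, 3), 0) with the 3 in direction c + 1; if k u ≤ 1, then w
-- also lies on v-direction c + 1, and v is adjacent to w by condition (2) or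
-- (3); these only get easier as the charge of the neighbour grows to 2, so
-- (2, x u, (1), 0) is a neighbour of v.
module Submission where

open import Defs
open import Data.List using (List; []; _∷_; _++_; length; replicate)
open import Data.List.Properties using (++-assoc; ++-identityʳ; ++-identityʳ-unique; ++-cancelˡ; ∷-injective; ∷-injectiveˡ; length-replicate)
open import Data.List.Relation.Unary.Any using (Any; here; there)
open import Data.Nat using (ℕ; zero; suc; _+_; _∸_; _≤_; _<_; z≤n; s≤s; s≤s⁻¹; _≟_)
open import Data.Nat.ListAction using (sum)
open import Data.Nat.Properties
  using (≤-refl; ≤-reflexive; ≤-trans; m≤m+n; m≤n+m; +-mono-≤; +-monoˡ-≤; +-monoʳ-≤; +-monoʳ-<;
         +-identityʳ; +-comm; m+n≤o⇒m≤o; m+n≤o⇒n≤o; m+[n∸m]≡n; m≤n⇒m<n∨m≡n; n≢0⇒n>0; ≤⇒≯; <⇒≱; <⇒≢)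
open import Data.Product using (∃-syntax; _×_; _,_; proj₁; proj₂)
open import Data.Sum using (_⊎_; inj₁; inj₂; swap)
open import Data.Empty using (⊥-elim)
open import Function using (_∘_)
open import Function.Bundles using (_⇔_; Equivalence)
import Function.Properties.Equivalence as ⇔
open import Relation.Nullary using (¬_; yes; no)
open import Relation.Binary.PropositionalEquality using (_≡_; _≢_; refl; sym; trans; cong; subst; subst₂)

private
  variable
    t : Tree
    v w : K4V t
    α β γ : List ℕ
    a b c c′ m n : ℕ
    ns : List ℕ

StrictlyBelow : List ℕ → List ℕ → Set
StrictlyBelow α β = ∃[ c ] OnDir α c β

StrictlyBelow⇒Below : StrictlyBelow α β → Below α β
StrictlyBelow⇒Below (c , r , β≡) = c ∷ r , β≡

Stacked-refl : Stacked α α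
Stacked-refl {α} = inj₁ ([] , sym (++-identityʳ α))

OnDir-irrefl : ¬ OnDir α c α
OnDir-irrefl {α} (r , α≡) with ++-identityʳ-unique α α≡
... | ()

OnDir-trans : OnDir α c β → StrictlyBelow β γ → OnDir α c γ
OnDir-trans {α} {c} (r , refl) (c′ , r′ , refl) = r ++ c′ ∷ r′ , ++-assoc α (c ∷ r) (c′ ∷ r′)

OnDir-asym : OnDir α c β → ¬ OnDir β c′ α
OnDir-asym α→β β→α = OnDir-irrefl (OnDir-trans α→β (_ , β→α))

OnDir-unique : OnDir α c β → OnDir α c′ β → c ≡ c′
OnDir-unique {α} (r , β≡) (r′ , β≡′) = ∷-injectiveˡ (++-cancelˡ α _ _ (trans (sym β≡) β≡′))

Stacked-∷⁻ : Stacked (a ∷ α) (b ∷ β) → a ≡ b × Stacked α β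
Stacked-∷⁻ (inj₁ (r , β≡)) with ∷-injective β≡
... | refl , β≡′ = refl , inj₁ (r , β≡′)
Stacked-∷⁻ (inj₂ (r , α≡)) with ∷-injective α≡
... | refl , α≡′ = refl , inj₂ (r , α≡′)

Below-common : Below α γ → Below β γ → Stacked α β
Below-common {[]}    _ _ = inj₁ (_ , refl)
Below-common {_ ∷ _} {β = []} _ _ = inj₂ (_ , refl)
Below-common {a ∷ α} {β = b ∷ β} (r , refl) (r′ , eq) with ∷-injective eq
... | refl , eq′ with Below-common {α} {β = β} (r , refl) (r′ , eq′)
...   | inj₁ (s , β≡) = inj₁ (s , cong (a ∷_) β≡)
...   | inj₂ (s , α≡) = inj₂ (s , cong (a ∷_) α≡)

data Position (α β : List ℕ) : Set where
  equal     : α ≡ β → Position α β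
  below     : StrictlyBelow α β → Position α β
  above     : StrictlyBelow β α → Position α β
  unstacked : ¬ Stacked α β → Position α β

Position-∷ : Position α β → Position (a ∷ α) (a ∷ β)
Position-∷ {a = a} (equal α≡β)            = equal (cong (a ∷_) α≡β)
Position-∷ {a = a} (below (c , r , β≡))   = below (c , r , cong (a ∷_) β≡)
Position-∷ {a = a} (above (c , r , α≡))   = above (c , r , cong (a ∷_) α≡)
Position-∷         (unstacked ¬stacked)   = unstacked (λ s → ¬stacked (proj₂ (Stacked-∷⁻ s)))

position : (α β : List ℕ) → Position α β
position []      []      = equal refl
position []      (c ∷ β) = below (c , β , refl)
position (c ∷ α) []      = above (c , α , refl)
position (a ∷ α) (b ∷ β) with a ≟ b
... | yes refl = Position-∷ (position α β)
... | no  a≢b  = unstacked (a≢b ∘ proj₁ ∘ Stacked-∷⁻)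

OnDir⇒child : OnDir α c β → Valid t β → c < deg t α ∸ 1
OnDir⇒child {α = α} {c = c} (r , refl) = child α
  where
  child : ∀ {T} α → Valid T (α ++ c ∷ r) → c < deg T α ∸ 1
  child {node _} []      (c< , _)    = c<
  child {node _} (_ ∷ α) (_ , valid) = child α valid

nth≤sum : ∀ ns c → nth ns c ≤ sum ns
nth≤sum []       c       = z≤n
nth≤sum (n ∷ ns) zero    = m≤m+n n (sum ns)
nth≤sum (n ∷ ns) (suc c) = ≤-trans (nth≤sum ns c) (m≤n+m (sum ns) n)

nth+nth≤sum : ∀ ns {i j} → i ≢ j → nth ns i + nth ns j ≤ sum ns
nth+nth≤sum []       _ = z≤n
nth+nth≤sum (n ∷ ns) {zero}  {zero}  0≢0 = ⊥-elim (0≢0 refl)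
nth+nth≤sum (n ∷ ns) {zero}  {suc j} _   = +-monoʳ-≤ n (nth≤sum ns j)
nth+nth≤sum (n ∷ ns) {suc i} {zero}  _   =
  subst (_≤ n + sum ns) (+-comm n (nth ns i)) (+-monoʳ-≤ n (nth≤sum ns i))
nth+nth≤sum (n ∷ ns) {suc i} {suc j} i≢j =
  ≤-trans (nth+nth≤sum ns (i≢j ∘ cong suc)) (m≤n+m (sum ns) n)

Any-positive⇒sum-positive : Any (0 <_) ns → 0 < sum ns
Any-positive⇒sum-positive {n ∷ ns} (here 0<n)  = ≤-trans 0<n (m≤m+n n (sum ns))
Any-positive⇒sum-positive {n ∷ ns} (there any) =
  ≤-trans (Any-positive⇒sum-positive any) (m≤n+m (sum ns) n)

sum-replicate-0 : ∀ n → sum (replicate n 0) ≡ 0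
sum-replicate-0 zero    = refl
sum-replicate-0 (suc n) = sum-replicate-0 n

module _ (v : K4V t) where

  private
    p+q+k≤3 : sum (p v) + sum (q v) + k v ≤ 3
    p+q+k≤3 = ≤-reflexive (total v)

  sum-p≤3 : sum (p v) ≤ 3
  sum-p≤3 = m+n≤o⇒m≤o (sum (p v)) (m+n≤o⇒m≤o _ p+q+k≤3)

  sum-q≤3 : sum (q v) ≤ 3
  sum-q≤3 = m+n≤o⇒n≤o (sum (p v)) (m+n≤o⇒m≤o _ p+q+k≤3)

  k≤2 : k v ≤ 2
  k≤2 = s≤s⁻¹ (≤-trans (+-monoˡ-≤ (k v) 1≤p+q) p+q+k≤3)
    where
    1≤p+q : 1 ≤ sum (p v) + sum (q v)
    1≤p+q = ≤-trans (Any-positive⇒sum-positive (p-pos v)) (m≤m+n _ _)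

  k<2⊎k≡2 : k v < 2 ⊎ k v ≡ 2
  k<2⊎k≡2 = m≤n⇒m<n∨m≡n k≤2

data FiresAlong (v : K4V t) (c m : ℕ) : Set where
  p-strict : c < length (p v) → 4 < nth (p v) c + m → FiresAlong v c m
  p-tight  : c < length (p v) → nth (p v) c + m ≡ 4 →
             ∃[ j ] (j < length (p v) × j ≢ c × nth (p v) j ≢ 0) → FiresAlong v c m
  q-strict : length (p v) ≤ c → 4 < nth (q v) (c ∸ length (p v)) + m → FiresAlong v c m

data AdjDirView (v w : K4V t) : Set where
  unstacked : ¬ Stacked (x v) (x w) → 4 ≤ k v + k w → AdjDirView v w
  along     : OnDir (x v) c (x w) → FiresAlong v c (k w) → AdjDirView v w

AdjDir-view : ∀ v w → AdjDir {t} v w → AdjDirView v w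
AdjDir-view _ _ (inj₁ (¬stacked , 4≤))                     = unstacked ¬stacked 4≤
AdjDir-view _ _ (inj₂ (inj₁ (_ , on , c< , inj₁ f)))       = along on (p-strict c< f)
AdjDir-view _ _ (inj₂ (inj₁ (_ , on , c< , inj₂ (f , j)))) = along on (p-tight c< f j)
AdjDir-view _ _ (inj₂ (inj₂ (_ , on , c≥ , f)))            = along on (q-strict c≥ f)

FiresAlong⇒AdjDir : ∀ v w → OnDir (x v) c (x w) → FiresAlong v c (k w) → AdjDir {t} v w
FiresAlong⇒AdjDir _ _ on (p-strict c< f)  = inj₂ (inj₁ (_ , on , c< , inj₁ f))
FiresAlong⇒AdjDir _ _ on (p-tight c< f j) = inj₂ (inj₁ (_ , on , c< , inj₂ (f , j)))
FiresAlong⇒AdjDir _ _ on (q-strict c≥ f)  = inj₂ (inj₂ (_ , on , c≥ , f))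

FiresAlong-mono : m ≤ n → FiresAlong v c m → FiresAlong v c n
FiresAlong-mono m≤n (p-strict c< f) = p-strict c< (≤-trans f (+-monoʳ-≤ _ m≤n))
FiresAlong-mono m≤n (q-strict c≥ f) = q-strict c≥ (≤-trans f (+-monoʳ-≤ _ m≤n))
FiresAlong-mono {n = n} {v = v} {c = c} m≤n (p-tight c< ≡4 j) with m≤n⇒m<n∨m≡n m≤n
... | inj₁ m<n  = p-strict c< (subst (_< nth (p v) c + n) ≡4 (+-monoʳ-< (nth (p v) c) m<n))
... | inj₂ refl = p-tight c< ≡4 j

¬FiresAlong-low : m < 2 → ¬ FiresAlong w c m
¬FiresAlong-low {w = w} m<2 (p-strict _ f) =
  ≤⇒≯ (+-mono-≤ (≤-trans (nth≤sum (p w) _) (sum-p≤3 w)) (s≤s⁻¹ m<2)) f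
¬FiresAlong-low {w = w} m<2 (q-strict _ f) =
  ≤⇒≯ (+-mono-≤ (≤-trans (nth≤sum (q w) _) (sum-q≤3 w)) (s≤s⁻¹ m<2)) f
¬FiresAlong-low {w = w} {c = c} m<2 (p-tight _ ≡4 (j , _ , j≢c , pj≢0)) =
  <⇒≢ (s≤s (+-mono-≤ pc≤2 (s≤s⁻¹ m<2))) ≡4
  where
  pc≤2 : nth (p w) c ≤ 2
  pc≤2 = s≤s⁻¹ (≤-trans (+-monoˡ-≤ (nth (p w) c) (n≢0⇒n>0 pj≢0))
                        (≤-trans (nth+nth≤sum (p w) j≢c) (sum-p≤3 w)))

AdjDir⇒x≢x : ∀ v w → AdjDir {t} v w → x v ≢ x w
AdjDir⇒x≢x v w d x≡x with AdjDir-view v w d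
... | unstacked ¬stacked _ = ¬stacked (subst (Stacked (x v)) x≡x Stacked-refl)
... | along on _           = OnDir-irrefl (subst (λ α → OnDir α _ (x w)) x≡x on)

Adj⇒x≢x : ∀ v w → Adj {t} v w → x v ≢ x w
Adj⇒x≢x v w (inj₁ d) = AdjDir⇒x≢x v w d
Adj⇒x≢x v w (inj₂ d) = AdjDir⇒x≢x w v d ∘ sym

Adj-low⇒StrictlyBelow : ∀ v w → k {t} v < 2 → Adj v w → StrictlyBelow (x v) (x w)
Adj-low⇒StrictlyBelow v w kv<2 = strictlyBelow
  where
  k+k<4 : k v + k w < 4
  k+k<4 = s≤s (+-mono-≤ (s≤s⁻¹ kv<2) (k≤2 w))

  strictlyBelow : Adj v w → StrictlyBelow (x v) (x w)
  strictlyBelow (inj₁ d) with AdjDir-view v w d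
  ... | unstacked _ 4≤ = ⊥-elim (<⇒≱ k+k<4 4≤)
  ... | along on _     = _ , on
  strictlyBelow (inj₂ d) with AdjDir-view w v d
  ... | unstacked _ 4≤ = ⊥-elim (<⇒≱ k+k<4 (subst (4 ≤_) (+-comm (k w) (k v)) 4≤))
  ... | along _ fires  = ⊥-elim (¬FiresAlong-low kv<2 fires)

Adj⇒FiresAlong : ∀ v w → OnDir (x v) c (x w) → Adj {t} v w → FiresAlong v c (k w)
Adj⇒FiresAlong v w on (inj₁ d) with AdjDir-view v w d
... | unstacked ¬stacked _ = ⊥-elim (¬stacked (inj₁ (StrictlyBelow⇒Below (_ , on))))
... | along on′ fires      = subst (λ c → FiresAlong v c (k w)) (OnDir-unique on′ on) fires
Adj⇒FiresAlong v w on (inj₂ d) with AdjDir-view w v d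
... | unstacked ¬stacked _ = ⊥-elim (¬stacked (inj₂ (StrictlyBelow⇒Below (_ , on))))
... | along on′ _          = ⊥-elim (OnDir-asym on on′)

vertexAt : (v : K4V t) (m : ℕ) (ns : List ℕ) → Any (0 <_) ns →
           length ns ≤ deg t (x v) ∸ 1 → sum ns + m ≡ 3 → K4V t
vertexAt {t} v m ns pos len≤ sum≡ =
  mkV m (x v) ns zeros (x-valid v) (deg≥3 v) pos lengths≡ total≡
  where
  zeros : List ℕ
  zeros = replicate (deg t (x v) ∸ 1 ∸ length ns) 0

  lengths≡ : length ns + length zeros ≡ deg t (x v) ∸ 1
  lengths≡ = trans (cong (length ns +_) (length-replicate _)) (m+[n∸m]≡n len≤)

  total≡ : sum ns + sum zeros + m ≡ 3
  total≡ = trans (cong (λ s → sum ns + s + m) (sum-replicate-0 (deg t (x v) ∸ 1 ∸ length ns)))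
                 (trans (cong (_+ m) (+-identityʳ (sum ns))) sum≡)

charge2At : K4V t → K4V t
charge2At v = vertexAt v 2 (1 ∷ []) (here (s≤s z≤n)) (≤-trans (s≤s z≤n) (s≤s⁻¹ (deg≥3 v))) refl

spike : ℕ → List ℕ
spike zero    = 3 ∷ []
spike (suc c) = 0 ∷ spike c

length-spike : ∀ c → length (spike c) ≡ suc c
length-spike zero    = refl
length-spike (suc c) = cong suc (length-spike c)

sum-spike : ∀ c → sum (spike c) ≡ 3
sum-spike zero    = refl
sum-spike (suc c) = sum-spike c

nth-spike : ∀ c → nth (spike c) c ≡ 3
nth-spike zero    = refl
nth-spike (suc c) = nth-spike c

Any-positive-spike : ∀ c → Any (0 <_) (spike c)
Any-positive-spike zero    = here (s≤s z≤n)
Any-positive-spike (suc c) = there (Any-positive-spike c)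

spikeAt : (v : K4V t) (c : ℕ) → c < deg t (x v) ∸ 1 → K4V t
spikeAt v c c< = vertexAt v 0 (spike c) (Any-positive-spike c)
  (subst (_≤ _) (sym (length-spike c)) c<) (trans (+-identityʳ _) (sum-spike c))

Twins : K4V t → K4V t → Set
Twins u v = ∀ w → Adj u w ⇔ Adj v w

Twins-sym : ∀ u v → Twins {t} u v → Twins v u
Twins-sym _ _ same w = ⇔.sym (same w)

Twins⇒¬Adj-at : ∀ u v w → Twins {t} u v → Adj u w → x w ≢ x v
Twins⇒¬Adj-at u v w same u~w = Adj⇒x≢x v w (Equivalence.to (same w) u~w) ∘ sym

Twins-unstacked⇒k≢2 : ∀ u v → Twins {t} u v → ¬ Stacked (x u) (x v) → k u ≢ 2
Twins-unstacked⇒k≢2 u v same ¬stacked ku≡2 =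
  Twins⇒¬Adj-at u v (charge2At v) same u~v₂ refl
  where
  u~v₂ : Adj u (charge2At v)
  u~v₂ = inj₁ (inj₁ (¬stacked , subst (λ m → 4 ≤ m + 2) (sym ku≡2) ≤-refl))

Twins⇒¬unstacked : ∀ u v w → Twins {t} u v → Adj u w → ¬ ¬ Stacked (x u) (x v)
Twins⇒¬unstacked u v w same u~w ¬stacked with k<2⊎k≡2 u | k<2⊎k≡2 v
... | inj₂ ku≡2 | _         = Twins-unstacked⇒k≢2 u v same ¬stacked ku≡2
... | inj₁ _    | inj₂ kv≡2 =
  Twins-unstacked⇒k≢2 v u (Twins-sym u v same) (¬stacked ∘ swap) kv≡2
... | inj₁ ku<2 | inj₁ kv<2 = ¬stacked (Below-common (StrictlyBelow⇒Below u<w) (StrictlyBelow⇒Below v<w))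
  where
  u<w : StrictlyBelow (x u) (x w)
  u<w = Adj-low⇒StrictlyBelow u w ku<2 u~w
  v<w : StrictlyBelow (x v) (x w)
  v<w = Adj-low⇒StrictlyBelow v w kv<2 (Equivalence.to (same w) u~w)

Twins⇒¬OnDir : ∀ u v w → Twins {t} u v → Adj u w → ¬ OnDir (x v) c (x u)
Twins⇒¬OnDir {c = c} u v w same u~w v→u with k<2⊎k≡2 u
... | inj₂ ku≡2 = Twins⇒¬Adj-at u v s same u~s refl
  where
  s : K4V _
  s = spikeAt v c (OnDir⇒child v→u (x-valid u))
  fires : FiresAlong s c (k u)
  fires = p-strict (subst (c <_) (sym (length-spike c)) ≤-refl)
                   (subst₂ (λ a b → 4 < a + b) (sym (nth-spike c)) (sym ku≡2) ≤-refl)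
  u~s : Adj u s
  u~s = inj₂ (FiresAlong⇒AdjDir s u v→u fires)
... | inj₁ ku<2 = Twins⇒¬Adj-at v u (charge2At u) (Twins-sym u v same) v~u₂ refl
  where
  w-on-v : OnDir (x v) c (x w)
  w-on-v = OnDir-trans v→u (Adj-low⇒StrictlyBelow u w ku<2 u~w)
  fires : FiresAlong v c 2
  fires = FiresAlong-mono (k≤2 w) (Adj⇒FiresAlong v w w-on-v (Equivalence.to (same w) u~w))
  v~u₂ : Adj v (charge2At u)
  v~u₂ = inj₁ (FiresAlong⇒AdjDir v (charge2At u) v→u fires)

mainTheorem4 : (t : Tree) (u v : K4V t) →
    (∀ w → Adj u w ⇔ Adj v w) →
    (∃[ w ] Adj u w) →
    x u ≡ x v
mainTheorem4 t u v same (w , u~w) with position (x u) (x v)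
... | equal x≡x          = x≡x
... | below (_ , u→v)    =
  ⊥-elim (Twins⇒¬OnDir v u w (Twins-sym u v same) (Equivalence.to (same w) u~w) u→v)
... | above (_ , v→u)    = ⊥-elim (Twins⇒¬OnDir u v w same u~w v→u)
... | unstacked ¬stacked = ⊥-elim (Twins⇒¬unstacked u v w same u~w ¬stacked)
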